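{- Let $P$ be a finite definite propositional logic program, let $\mathit{complete}$ be any procedure that, given a nonempty definite program $Q$, returns a collection complete for $Q$, and let $L\subseteq\mathit{Lit}(P)$. Define $s(P,L)=1$ if $[P]_L=\emptyset$ or $L$ is not consistent, and otherwise $s(P,L)=\sum_{A\in\mathcal A}s(P,L\cup A)$, where $\mathcal A=\mathit{complete}([P]_L)$. Then $P$ has at most $s(P,L)$ stable models consistent with $L$. In particular, $P$ has at most $s(P,\emptyset)$ stable models.
   Context: A clause is an expression $p\leftarrow B$ (definite clause) or $\leftarrow B$ (constraint), where $p$ is an atom (the head $h(c)$) and $B$ is a finite set of literals (atoms $a$ or negated atoms $\mathrm{not}(a)$). $b^+(c)$ is the set of atoms occurring positively in the body, $b^-(c)$ the set of atoms occurring negated. A logic program is a finite set of clauses; definite if all clauses are definite. $\mathit{At}(P)$ is the set of atoms of $P$ and $\mathit{Lit}(P)=\mathit{At}(P)\cup\{\mathrm{not}(a):a\in\mathit{At}(P)\}$. $M\subseteq\mathit{At}(P)$ is a stable model of $P$ if $M$ satisfies every constraint of $P$ and $M$ is the least model of the reduct $P^M$ (delete the definite clauses $c$ with $b^-(c)\cap M\neq\emptyset$, drop negated literals from the remaining definite clauses). For $L\subseteq\mathit{Lit}(P)$: $L^+=\{a:a\in L\}$, $L^-=\{a:\mathrm{not}(a)\in L\}$, $L^0=L^+\cup L^-$; $L$ is consistent if $L^+\cap L^-=\emptyset$; $M$ is consistent with $L$ if $L^+\subseteq M$ and $L^-\cap M=\emptyset$. $[P]_L$ is obtained from $P$ by removing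 every clause $c$ with $b^+(c)\cap L^-\neq\emptyset$, with $b^-(c)\cap L^+\neq\emptyset$, or with $h(c)\in L^0$, and then removing all occurrences of literals of $L$ from the bodies of the remaining clauses. A nonempty collection $\mathcal A$ of nonempty subsets of $\mathit{Lit}(Q)$ is complete for $Q$ if every stable model of $Q$ is consistent with at least one member of $\mathcal A$. -}

module Defs where

open import Data.Nat using (ℕ; _+_; _≤_)
open import Data.Fin using (Fin; _≟_)
open import Data.Fin.Subset using (Subset) renaming (_∈_ to _∈ₛ_; _∉_ to _∉ₛ_; _⊆_ to _⊆ₛ_)
open import Data.Fin.Subset.Properties using () renaming (_∈?_ to _∈?ₛ_)
open import Data.Bool using (Bool; true; false; _∧_; _∨_; not)
open import Data.List using (List; []; _∷_; _++_; map; length)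
open import Data.List.Membership.Propositional using (_∈_)
open import Data.List.Relation.Unary.All using (All)
open import Data.List.Relation.Unary.Any using (Any)
open import Data.List.Relation.Unary.Unique.Propositional using (Unique)
open import Data.Product using (_×_)
open import Data.Sum using (_⊎_)
open import Data.Empty using (⊥)
open import Relation.Nullary using (¬_)
open import Relation.Nullary.Decidable using (⌊_⌋)
open import Relation.Binary.PropositionalEquality using (_≡_; _≢_)

data Lit (k : ℕ) : Set where
  atm : Fin k → Lit k
  naf : Fin k → Lit k

litAtom : ∀ {k} → Lit k → Fin k
litAtom (atm a) = a
litAtom (naf a) = a

-- Definite clause  h ← b⁺ ∪ not(b⁻)  (finite body, given as lists).
record Clause (k : ℕ) : Set where
  constructor _⇐_,_
  field
    head : Fin k
    bpos : List (Fin k)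
    bneg : List (Fin k)
open Clause public

Program : ℕ → Set
Program k = List (Clause k)

AtomOf : ∀ {k} → Program k → Fin k → Set
AtomOf P a = Any (λ c → (a ≡ head c) ⊎ (a ∈ bpos c) ⊎ (a ∈ bneg c)) P

LitsOf : ∀ {k} → Program k → List (Lit k) → Set
LitsOf P A = All (λ l → AtomOf P (litAtom l)) A

-- M is a model of a definite program (negative bodies ignored: used on reducts,
-- whose negative bodies are empty).
IsModel : ∀ {k} → Program k → Subset k → Set
IsModel R M = All (λ c → All (λ a → a ∈ₛ M) (bpos c) → head c ∈ₛ M) R

IsLeastModel : ∀ {k} → Program k → Subset k → Set
IsLeastModel R M = IsModel R M × (∀ N → IsModel R N → M ⊆ₛ N)

bfilter : ∀ {A : Set} → (A → Bool) → List A → List A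
bfilter p [] = []
bfilter p (x ∷ xs) with p x
... | true  = x ∷ bfilter p xs
... | false = bfilter p xs

anyB : ∀ {A : Set} → (A → Bool) → List A → Bool
anyB p [] = false
anyB p (x ∷ xs) = p x ∨ anyB p xs

reduct : ∀ {k} → Program k → Subset k → Program k
reduct [] M = []
reduct (c ∷ P) M with anyB (λ a → ⌊ a ∈?ₛ M ⌋) (bneg c)
... | true  = reduct P M
... | false = (head c ⇐ bpos c , []) ∷ reduct P M

-- M ⊆ At(P) is a stable model of P (P definite, so no constraints).
IsStableModel : ∀ {k} → Program k → Subset k → Set
IsStableModel P M = (∀ a → a ∈ₛ M → AtomOf P a) × IsLeastModel (reduct P M) M

Consistent : ∀ {k} → List (Lit k) → Set
Consistent L = ∀ a → atm a ∈ L → naf a ∈ L → ⊥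

ConsistentWith : ∀ {k} → Subset k → List (Lit k) → Set
ConsistentWith M L = (∀ a → atm a ∈ L → a ∈ₛ M) × (∀ a → naf a ∈ L → a ∉ₛ M)

inPos : ∀ {k} → List (Lit k) → Fin k → Bool
inPos [] a = false
inPos (atm b ∷ L) a = ⌊ a ≟ b ⌋ ∨ inPos L a
inPos (naf b ∷ L) a = inPos L a

inNeg : ∀ {k} → List (Lit k) → Fin k → Bool
inNeg [] a = false
inNeg (atm b ∷ L) a = inNeg L a
inNeg (naf b ∷ L) a = ⌊ a ≟ b ⌋ ∨ inNeg L a

keepClause : ∀ {k} → List (Lit k) → Clause k → Bool
keepClause L c =
  not (anyB (inNeg L) (bpos c)) ∧ not (anyB (inPos L) (bneg c))
  ∧ not (inPos L (head c) ∨ inNeg L (head c))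

stripClause : ∀ {k} → List (Lit k) → Clause k → Clause k
stripClause L c =
  head c ⇐ bfilter (λ a → not (inPos L a)) (bpos c) , bfilter (λ a → not (inNeg L a)) (bneg c)

simplify : ∀ {k} → Program k → List (Lit k) → Program k
simplify P L = map (stripClause L) (bfilter (keepClause L) P)

IsCompleteFor : ∀ {k} → Program k → List (List (Lit k)) → Set
IsCompleteFor Q 𝒜 =
  (𝒜 ≢ []) × All (λ A → (A ≢ []) × LitsOf Q A) 𝒜
  × (∀ M → IsStableModel Q M → Any (ConsistentWith M) 𝒜)

CompleteProcedure : ℕ → Set
CompleteProcedure k = Program k → List (List (Lit k))

IsCompleteProcedure : ∀ {k} → CompleteProcedure k → Set
IsCompleteProcedure complete = ∀ Q → Q ≢ [] → IsCompleteFor Q (complete Q)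

-- s(P, L), given as the graph of its recursive definition:
-- SVal P complete L n  means  s(P,L) = n.

mutual
  data SVal {k} (P : Program k) (complete : CompleteProcedure k)
            : List (Lit k) → ℕ → Set where
    s-empty : ∀ {L} → simplify P L ≡ [] → SVal P complete L 1
    s-incons : ∀ {L} → ¬ Consistent L → SVal P complete L 1
    s-step : ∀ {L n} → simplify P L ≢ [] → Consistent L
           → SSum P complete L (complete (simplify P L)) n
           → SVal P complete L n

  data SSum {k} (P : Program k) (complete : CompleteProcedure k)
            (L : List (Lit k)) : List (List (Lit k)) → ℕ → Set where
    sum-nil : SSum P complete L [] 0
    sum-cons : ∀ {A 𝒜 m r} → SVal P complete (L ++ A) m
             → SSum P complete L 𝒜 r → SSum P complete L (A ∷ 𝒜) (m + r)

AtMostStableModels : ∀ {k} → Program k → List (Lit k) → ℕ → Set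
AtMostStableModels {k} P L n =
  (Ms : List (Subset k)) → Unique Ms
  → All (λ M → IsStableModel P M × ConsistentWith M L) Ms → length Ms ≤ n

{-# OPTIONS --safe #-}

-- If M is a stable model of P consistent with L, then M ∩ At([P]_L) is a stable model of
-- [P]_L: for every model N' of a reduct of [P]_L by a subset of M, the set M ∩ (L⁺ ∪ N') is a
-- model of P^M, so M ⊆ L⁺ ∪ N' by minimality. Completeness then yields A ∈ complete([P]_L)
-- with M consistent with L ∪ A, so the models counted at L are covered by those counted at
-- the children L ∪ A, and induction along s with the union bound at each sum gives the
-- result. At the leaves an inconsistent L admits no model, and for [P]_L = ∅ the only
-- candidate is L⁺. The recursion is well founded because each A fixes an atom outside L⁰.

module Submission where

open import Defs
open import Data.Nat using (ℕ; suc; _+_; _≤_; z≤n; s≤s)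
open import Data.Nat.Properties using (+-suc; +-mono-≤; ≤-reflexive; ≤-trans)
open import Data.Bool using (true; false)
open import Data.Fin using (Fin; _≟_)
open import Data.Fin.Properties using (all?)
open import Data.Fin.Subset using (Subset; _⊂_; _⊃_) renaming (_∈_ to _∈ₛ_; _⊆_ to _⊆ₛ_; ⊥ to ∅)
open import Data.Fin.Subset.Properties using (⊆-refl; ⊆-antisym; ∉⊥) renaming (_∈?_ to _∈?ₛ_)
open import Data.Fin.Subset.Induction using (Acc; acc; ⊃-wellFounded)
open import Data.Vec using (tabulate)
open import Data.Vec.Properties using (lookup∘tabulate; []=⇒lookup; lookup⇒[]=)
open import Data.List using (List; []; _∷_; _++_; map; filter; length)
open import Data.List.Membership.Propositional using (_∈_; _∉_; find; lose)
open import Data.List.Membership.Propositional.Properties using (∈-++⁺ˡ; ∈-++⁺ʳ; ∈-++⁻; ∈-filter⁺; ∈-filter⁻; ∈-map∘filter⁺; ∈-map∘filter⁻)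
open import Data.List.Relation.Unary.All as All using (All; []; _∷_)
open import Data.List.Relation.Unary.Any using (Any; here; there; any?; toSum; fromSum)
open import Data.List.Relation.Unary.Unique.Propositional using (Unique)
open import Data.List.Relation.Unary.AllPairs using ([]; _∷_)
open import Data.List.Relation.Binary.Sublist.Propositional using ([]; _∷_; _∷ʳ_) renaming (_⊆_ to _⊑_)
open import Data.List.Relation.Binary.Sublist.Propositional.Properties using (All-resp-⊆)
open import Data.Product using (Σ; ∃-syntax; ∃₂; _×_; _,_; proj₁; proj₂)
open import Data.Sum as Sum using (_⊎_; inj₁; inj₂; [_,_]′; fromInj₁; fromInj₂)
open import Data.Empty using (⊥; ⊥-elim)
open import Function using (_∘_)
open import Relation.Nullary using (¬_; Dec; yes; no; does; proof; _because_; ¬?; _⊎-dec_; _×-dec_; _→-dec_; contradiction)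
open import Relation.Nullary.Reflects using (Reflects; ofʸ; ofⁿ; invert; _⊎-reflects_)
open import Relation.Nullary.Decidable using (⌊_⌋; dec-true)
open import Relation.Unary using (Decidable)
open import Relation.Binary.PropositionalEquality using (_≡_; _≢_; refl; sym; trans; cong; subst)

private
  variable
    A B : Set
    k : ℕ

empty? : (xs : List A) → Dec (xs ≡ [])
empty? [] = yes refl
empty? (_ ∷ _) = no λ ()

map-reflects : ∀ {b} → (A → B) → (B → A) → Reflects A b → Reflects B b
map-reflects f g (ofʸ x) = ofʸ (f x)
map-reflects f g (ofⁿ ¬x) = ofⁿ (¬x ∘ g)

-- The decision procedures below are built so that their `does` fields are definitionally the
-- Boolean tests of Defs; `bfilter-filter` then turns [P]_L and P^M into ordinary filters.
-- `reduct` tests membership with ⌊_⌋ = isYes, which is not definitionally `does`.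
isYes-reflects : (A? : Dec A) → Reflects A ⌊ A? ⌋
isYes-reflects (yes x) = ofʸ x
isYes-reflects (no ¬x) = ofⁿ ¬x

anyB? : {P : A → Set} → Decidable P → Decidable (Any P)
anyB? {P = P} P? xs = anyB (does ∘ P?) xs because reflects xs
  where
  reflects : ∀ xs → Reflects (Any P xs) (anyB (does ∘ P?) xs)
  reflects [] = ofⁿ λ ()
  reflects (x ∷ xs) = map-reflects fromSum toSum (proof (P? x) ⊎-reflects reflects xs)

bfilter-filter : {P : A → Set} (P? : Decidable P) → ∀ xs → bfilter (does ∘ P?) xs ≡ filter P? xs
bfilter-filter P? [] = refl
bfilter-filter P? (x ∷ xs) with does (P? x)
... | true = cong (x ∷_) (bfilter-filter P? xs)
... | false = bfilter-filter P? xs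

toSubset : {P : Fin k → Set} → Decidable P → Subset k
toSubset P? = tabulate (does ∘ P?)

module _ {P : Fin k → Set} (P? : Decidable P) {x : Fin k} where

  ∈-toSubset⁺ : P x → x ∈ₛ toSubset P?
  ∈-toSubset⁺ px = lookup⇒[]= x _ (trans (lookup∘tabulate _ x) (dec-true (P? x) px))

  ∈-toSubset⁻ : x ∈ₛ toSubset P? → P x
  ∈-toSubset⁻ x∈ =
    invert (subst (Reflects (P x)) (trans (sym (lookup∘tabulate _ x)) ([]=⇒lookup x∈)) (proof (P? x)))

Unique-resp-⊆ : ∀ {xs ys : List A} → xs ⊑ ys → Unique ys → Unique xs
Unique-resp-⊆ [] [] = []
Unique-resp-⊆ (_ ∷ʳ xs⊑ys) (_ ∷ unique) = Unique-resp-⊆ xs⊑ys unique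
Unique-resp-⊆ (refl ∷ xs⊑ys) (x∉ ∷ unique) = All-resp-⊆ xs⊑ys x∉ ∷ Unique-resp-⊆ xs⊑ys unique

AtMost : (A → Set) → ℕ → Set
AtMost P n = ∀ xs → Unique xs → All P xs → length xs ≤ n

module _ {P Q : A → Set} where

  atMost-mono : ∀ {n} → (∀ {x} → P x → Q x) → AtMost Q n → AtMost P n
  atMost-mono P⇒Q bound xs unique ps = bound xs unique (All.map P⇒Q ps)

  partition-⊎ : ∀ {xs} → All (λ x → P x ⊎ Q x) xs
              → ∃₂ λ ys zs → ys ⊑ xs × zs ⊑ xs × All P ys × All Q zs × length xs ≡ length ys + length zs
  partition-⊎ [] = [] , [] , [] , [] , [] , [] , refl
  partition-⊎ {x ∷ _} (inj₁ px ∷ pqs) with partition-⊎ pqs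
  ... | ys , zs , ys⊑ , zs⊑ , ps , qs , eq = x ∷ ys , zs , refl ∷ ys⊑ , x ∷ʳ zs⊑ , px ∷ ps , qs , cong suc eq
  partition-⊎ {x ∷ _} (inj₂ qx ∷ pqs) with partition-⊎ pqs
  ... | ys , zs , ys⊑ , zs⊑ , ps , qs , eq =
    ys , x ∷ zs , x ∷ʳ ys⊑ , refl ∷ zs⊑ , ps , qx ∷ qs , trans (cong suc eq) (sym (+-suc _ _))

  atMost-∪ : ∀ {m n} → AtMost P m → AtMost Q n → AtMost (λ x → P x ⊎ Q x) (m + n)
  atMost-∪ boundP boundQ xs unique pqs with partition-⊎ pqs
  ... | ys , zs , ys⊑ , zs⊑ , ps , qs , eq = ≤-trans (≤-reflexive eq)
    (+-mono-≤ (boundP ys (Unique-resp-⊆ ys⊑ unique) ps) (boundQ zs (Unique-resp-⊆ zs⊑ unique) qs))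

module _ {P : A → Set} where

  atMost-none : ∀ {n} → (∀ {x} → ¬ P x) → AtMost P n
  atMost-none _ [] _ _ = z≤n
  atMost-none ¬P (_ ∷ _) _ (px ∷ _) = contradiction px ¬P

  atMost-subsingleton : (∀ {x y} → P x → P y → x ≡ y) → AtMost P 1
  atMost-subsingleton _ [] _ _ = z≤n
  atMost-subsingleton _ (_ ∷ []) _ _ = s≤s z≤n
  atMost-subsingleton same (_ ∷ _ ∷ _) ((x≢y ∷ _) ∷ _) (px ∷ py ∷ _) = contradiction (same px py) x≢y

atm∈? : (L : List (Lit k)) → Decidable (λ a → atm a ∈ L)
atm∈? L a = inPos L a because reflects L
  where
  reflects : ∀ L → Reflects (atm a ∈ L) (inPos L a)
  reflects [] = ofⁿ λ ()
  reflects (atm b ∷ L) = map-reflects (λ { (inj₁ refl) → here refl ; (inj₂ p) → there p })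
                                      (λ { (here refl) → inj₁ refl ; (there p) → inj₂ p })
                                      (isYes-reflects (a ≟ b) ⊎-reflects reflects L)
  reflects (naf b ∷ L) = map-reflects there (λ { (there p) → p }) (reflects L)

naf∈? : (L : List (Lit k)) → Decidable (λ a → naf a ∈ L)
naf∈? L a = inNeg L a because reflects L
  where
  reflects : ∀ L → Reflects (naf a ∈ L) (inNeg L a)
  reflects [] = ofⁿ λ ()
  reflects (naf b ∷ L) = map-reflects (λ { (inj₁ refl) → here refl ; (inj₂ p) → there p })
                                      (λ { (here refl) → inj₁ refl ; (there p) → inj₂ p })
                                      (isYes-reflects (a ≟ b) ⊎-reflects reflects L)
  reflects (atm b ∷ L) = map-reflects there (λ { (there p) → p }) (reflects L)

Determined : List (Lit k) → Fin k → Set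
Determined L a = atm a ∈ L ⊎ naf a ∈ L

determined? : (L : List (Lit k)) → Decidable (Determined L)
determined? L a = atm∈? L a ⊎-dec naf∈? L a

determined : List (Lit k) → Subset k
determined L = toSubset (determined? L)

lit-determined : ∀ {L : List (Lit k)} l → l ∈ L → Determined L (litAtom l)
lit-determined (atm a) = inj₁
lit-determined (naf a) = inj₂

atomOf? : (P : Program k) → Decidable (AtomOf P)
atomOf? P a = any? (λ c → a ≟ head c ⊎-dec any? (a ≟_) (bpos c) ⊎-dec any? (a ≟_) (bneg c)) P

consistent? : (L : List (Lit k)) → Dec (Consistent L)
consistent? L = all? λ a → atm∈? L a →-dec ¬? (naf∈? L a)

Kept : List (Lit k) → Clause k → Set
Kept L c = ¬ Any (λ x → naf x ∈ L) (bpos c) × ¬ Any (λ x → atm x ∈ L) (bneg c) × ¬ Determined L (head c)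

kept? : (L : List (Lit k)) → Decidable (Kept L)
kept? L c = ¬? (anyB? (naf∈? L) (bpos c)) ×-dec ¬? (anyB? (atm∈? L) (bneg c))
            ×-dec ¬? (atm∈? L (head c) ⊎-dec naf∈? L (head c))

simplify-filter : ∀ (P : Program k) L → simplify P L ≡ map (stripClause L) (filter (kept? L) P)
simplify-filter P L = cong (map (stripClause L)) (bfilter-filter (kept? L) P)

module _ (L : List (Lit k)) (c : Clause k) where

  bpos-strip : bpos (stripClause L c) ≡ filter (¬? ∘ atm∈? L) (bpos c)
  bpos-strip = bfilter-filter (¬? ∘ atm∈? L) (bpos c)

  bneg-strip : bneg (stripClause L c) ≡ filter (¬? ∘ naf∈? L) (bneg c)
  bneg-strip = bfilter-filter (¬? ∘ naf∈? L) (bneg c)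

  ∈-bpos-strip⁺ : ∀ {x} → x ∈ bpos c → atm x ∉ L → x ∈ bpos (stripClause L c)
  ∈-bpos-strip⁺ x∈ ¬atm = subst (_ ∈_) (sym bpos-strip) (∈-filter⁺ (¬? ∘ atm∈? L) x∈ ¬atm)

  ∈-bpos-strip⁻ : ∀ {x} → x ∈ bpos (stripClause L c) → x ∈ bpos c × atm x ∉ L
  ∈-bpos-strip⁻ = ∈-filter⁻ (¬? ∘ atm∈? L) ∘ subst (_ ∈_) bpos-strip

  ∈-bneg-strip⁺ : ∀ {x} → x ∈ bneg c → naf x ∉ L → x ∈ bneg (stripClause L c)
  ∈-bneg-strip⁺ x∈ ¬naf = subst (_ ∈_) (sym bneg-strip) (∈-filter⁺ (¬? ∘ naf∈? L) x∈ ¬naf)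

  ∈-bneg-strip⁻ : ∀ {x} → x ∈ bneg (stripClause L c) → x ∈ bneg c × naf x ∉ L
  ∈-bneg-strip⁻ = ∈-filter⁻ (¬? ∘ naf∈? L) ∘ subst (_ ∈_) bneg-strip

module _ (P : Program k) (L : List (Lit k)) where

  ∈-simplify⁺ : ∀ {c} → c ∈ P → Kept L c → stripClause L c ∈ simplify P L
  ∈-simplify⁺ c∈P kept rewrite simplify-filter P L =
    ∈-map∘filter⁺ (stripClause L) (kept? L) (_ , c∈P , refl , kept)

  ∈-simplify⁻ : ∀ {d} → d ∈ simplify P L → ∃[ c ] c ∈ P × d ≡ stripClause L c × Kept L c
  ∈-simplify⁻ d∈ rewrite simplify-filter P L = ∈-map∘filter⁻ (stripClause L) (kept? L) d∈

  simplify-undetermined : ∀ {a} → AtomOf (simplify P L) a → ¬ Determined L a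
  simplify-undetermined at with find at
  ... | d , d∈ , occurrence with ∈-simplify⁻ d∈
  ... | c , _ , refl , ¬naf-bpos , ¬atm-bneg , ¬head with occurrence
  ... | inj₁ refl = ¬head
  ... | inj₂ (inj₁ a∈) =
    let a∈c , ¬atm = ∈-bpos-strip⁻ L c a∈ in [ ¬atm , (λ naf∈ → ¬naf-bpos (lose a∈c naf∈)) ]′
  ... | inj₂ (inj₂ a∈) =
    let a∈c , ¬naf = ∈-bneg-strip⁻ L c a∈ in [ (λ atm∈ → ¬atm-bneg (lose a∈c atm∈)) , ¬naf ]′

Blocked : Subset k → Clause k → Set
Blocked M c = Any (_∈ₛ M) (bneg c)

blocked? : (M : Subset k) → Decidable (Blocked M)
blocked? M c = anyB? (λ a → ⌊ a ∈?ₛ M ⌋ because isYes-reflects (a ∈?ₛ M)) (bneg c)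

positivePart : Clause k → Clause k
positivePart c = head c ⇐ bpos c , []

reduct-filter : ∀ (P : Program k) M → reduct P M ≡ map positivePart (filter (¬? ∘ blocked? M) P)
reduct-filter [] M = refl
reduct-filter (c ∷ P) M with anyB (λ a → ⌊ a ∈?ₛ M ⌋) (bneg c)
... | true = reduct-filter P M
... | false = cong (positivePart c ∷_) (reduct-filter P M)

module _ {P : Program k} {M : Subset k} where

  ∈-reduct⁺ : ∀ {c} → c ∈ P → ¬ Blocked M c → positivePart c ∈ reduct P M
  ∈-reduct⁺ c∈P ¬blocked rewrite reduct-filter P M =
    ∈-map∘filter⁺ positivePart (¬? ∘ blocked? M) (_ , c∈P , refl , ¬blocked)

  ∈-reduct⁻ : ∀ {d} → d ∈ reduct P M → ∃[ c ] c ∈ P × d ≡ positivePart c × ¬ Blocked M c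
  ∈-reduct⁻ d∈ rewrite reduct-filter P M = ∈-map∘filter⁻ positivePart (¬? ∘ blocked? M) d∈

  reduct-model⁻ : ∀ {N c} → IsModel (reduct P M) N → c ∈ P → ¬ Blocked M c → All (_∈ₛ N) (bpos c) → head c ∈ₛ N
  reduct-model⁻ model c∈P ¬blocked = All.lookup model (∈-reduct⁺ c∈P ¬blocked)

  reduct-model⁺ : ∀ {N} → (∀ {c} → c ∈ P → ¬ Blocked M c → All (_∈ₛ N) (bpos c) → head c ∈ₛ N)
                → IsModel (reduct P M) N
  reduct-model⁺ {N} closed = All.tabulate (satisfied ∘ ∈-reduct⁻)
    where
    satisfied : ∀ {d} → ∃[ c ] c ∈ P × d ≡ positivePart c × ¬ Blocked M c → All (_∈ₛ N) (bpos d) → head d ∈ₛ N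
    satisfied (c , c∈P , refl , ¬blocked) = closed c∈P ¬blocked

consistentWith⇒consistent : ∀ {M : Subset k} {L} → ConsistentWith M L → Consistent L
consistentWith⇒consistent (pos , neg) a atm∈ naf∈ = neg a naf∈ (pos a atm∈)

consistentWith-++ : ∀ {M : Subset k} {L A} → ConsistentWith M L → ConsistentWith M A → ConsistentWith M (L ++ A)
consistentWith-++ {L = L} (posL , negL) (posA , negA) =
  (λ a → [ posL a , posA a ]′ ∘ ∈-++⁻ L) , (λ a → [ negL a , negA a ]′ ∘ ∈-++⁻ L)

applicable⇒kept : ∀ {M : Subset k} {L c} → ConsistentWith M L
                → All (_∈ₛ M) (bpos c) → ¬ Blocked M c → head c ∈ₛ M → atm (head c) ∉ L → Kept L c
applicable⇒kept (pos , neg) bpos⊆M ¬blocked head∈M ¬atm =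
    (λ naf∈bpos → let x , x∈ , naf∈ = find naf∈bpos in neg x naf∈ (All.lookup bpos⊆M x∈))
  , (λ atm∈bneg → let x , x∈ , atm∈ = find atm∈bneg in ¬blocked (lose x∈ (pos x atm∈)))
  , [ ¬atm , (λ naf∈ → neg _ naf∈ head∈M) ]′

module _ (P : Program k) {L : List (Lit k)} {M : Subset k}
         (least : IsLeastModel (reduct P M) M) (consistent : ConsistentWith M L) where

  private
    Q = simplify P L

  stable⊆L⁺∪model : ∀ {N N'} → N ⊆ₛ M → IsModel (reduct Q N) N' → ∀ {a} → a ∈ₛ M → atm a ∈ L ⊎ a ∈ₛ N'
  stable⊆L⁺∪model {N} {N'} N⊆M model' a∈M = proj₂ (∈-toSubset⁻ bound? (proj₂ least bound bound-model a∈M))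
    where
    bound? : Decidable (λ a → a ∈ₛ M × (atm a ∈ L ⊎ a ∈ₛ N'))
    bound? a = a ∈?ₛ M ×-dec (atm∈? L a ⊎-dec a ∈?ₛ N')
    bound = toSubset bound?

    closed : ∀ {c} → c ∈ P → ¬ Blocked M c → All (_∈ₛ bound) (bpos c) → head c ∈ₛ bound
    closed {c} c∈P ¬blocked bpos⊆bound = ∈-toSubset⁺ bound? (head∈M , forced (atm∈? L (head c)))
      where
      bpos⊆M = All.map (proj₁ ∘ ∈-toSubset⁻ bound?) bpos⊆bound
      head∈M = reduct-model⁻ (proj₁ least) c∈P ¬blocked bpos⊆M

      ¬blocked' : ¬ Blocked N (stripClause L c)
      ¬blocked' b = let x , x∈ , x∈N = find b in ¬blocked (lose (proj₁ (∈-bneg-strip⁻ L c x∈)) (N⊆M x∈N))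

      bpos⊆N' : All (_∈ₛ N') (bpos (stripClause L c))
      bpos⊆N' = All.tabulate λ x∈ → let x∈c , ¬atm = ∈-bpos-strip⁻ L c x∈ in
        fromInj₂ (λ atm∈ → contradiction atm∈ ¬atm) (proj₂ (∈-toSubset⁻ bound? (All.lookup bpos⊆bound x∈c)))

      forced : Dec (atm (head c) ∈ L) → atm (head c) ∈ L ⊎ head c ∈ₛ N'
      forced (yes atm∈) = inj₁ atm∈
      forced (no ¬atm) = inj₂ (reduct-model⁻ model' c'∈Q ¬blocked' bpos⊆N')
        where c'∈Q = ∈-simplify⁺ P L c∈P (applicable⇒kept consistent bpos⊆M ¬blocked head∈M ¬atm)

    bound-model : IsModel (reduct P M) bound
    bound-model = reduct-model⁺ closed

  simplify-empty⇒⊆L⁺ : Q ≡ [] → ∀ {a} → a ∈ₛ M → atm a ∈ L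
  simplify-empty⇒⊆L⁺ empty a∈M =
    fromInj₁ (⊥-elim ∘ ∉⊥) (stable⊆L⁺∪model ⊆-refl (subst (λ R → IsModel (reduct R M) ∅) (sym empty) []) a∈M)

  restriction? : Decidable (λ a → a ∈ₛ M × AtomOf Q a)
  restriction? a = a ∈?ₛ M ×-dec atomOf? Q a

  restriction : Subset k
  restriction = toSubset restriction?

  restriction-model : IsModel (reduct Q restriction) restriction
  restriction-model = reduct-model⁺ closed
    where
    closed : ∀ {d} → d ∈ Q → ¬ Blocked restriction d → All (_∈ₛ restriction) (bpos d) → head d ∈ₛ restriction
    closed d∈Q ¬blocked bpos⊆restriction with ∈-simplify⁻ P L d∈Q
    ... | c , c∈P , refl , _ =
      ∈-toSubset⁺ restriction? (reduct-model⁻ (proj₁ least) c∈P ¬blocked-M bpos⊆M , lose d∈Q (inj₁ refl))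
      where
      pos-atom : ∀ {x} → x ∈ bpos c → Dec (atm x ∈ L) → x ∈ₛ M
      pos-atom x∈ (yes atm∈) = proj₁ consistent _ atm∈
      pos-atom x∈ (no ¬atm) =
        proj₁ (∈-toSubset⁻ restriction? (All.lookup bpos⊆restriction (∈-bpos-strip⁺ L c x∈ ¬atm)))

      bpos⊆M : All (_∈ₛ M) (bpos c)
      bpos⊆M = All.tabulate λ {x} x∈ → pos-atom x∈ (atm∈? L x)

      neg-atom : ∀ {x} → x ∈ bneg c → x ∈ₛ M → Dec (naf x ∈ L) → ⊥
      neg-atom x∈ x∈M (yes naf∈) = proj₂ consistent _ naf∈ x∈M
      neg-atom x∈ x∈M (no ¬naf) =
        ¬blocked (lose x∈d (∈-toSubset⁺ restriction? (x∈M , lose d∈Q (inj₂ (inj₂ x∈d)))))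
        where x∈d = ∈-bneg-strip⁺ L c x∈ ¬naf

      ¬blocked-M : ¬ Blocked M c
      ¬blocked-M b = let x , x∈ , x∈M = find b in neg-atom x∈ x∈M (naf∈? L x)

  restriction-least : ∀ N' → IsModel (reduct Q restriction) N' → restriction ⊆ₛ N'
  restriction-least N' model' x∈ =
    let x∈M , x-atom = ∈-toSubset⁻ restriction? x∈ in
    fromInj₂ (λ atm∈ → contradiction (inj₁ atm∈) (simplify-undetermined P L x-atom))
             (stable⊆L⁺∪model (proj₁ ∘ ∈-toSubset⁻ restriction?) model' x∈M)

  restriction-stable : IsStableModel Q restriction
  restriction-stable = (λ _ → proj₂ ∘ ∈-toSubset⁻ restriction?) , restriction-model , restriction-least

  restriction-consistentWith : ∀ {A} → LitsOf Q A → ConsistentWith restriction A → ConsistentWith M A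
  restriction-consistentWith lits (pos , neg) =
      (λ a atm∈ → proj₁ (∈-toSubset⁻ restriction? (pos a atm∈)))
    , (λ a naf∈ a∈M → neg a naf∈ (∈-toSubset⁺ restriction? (a∈M , All.lookup lits naf∈)))

determined-⊂ : ∀ (P : Program k) L {A} → A ≢ [] → LitsOf (simplify P L) A → determined L ⊂ determined (L ++ A)
determined-⊂ P L {[]} A≢[] _ = contradiction refl A≢[]
determined-⊂ P L {l ∷ A} _ (l-atom ∷ _) =
    ∈-toSubset⁺ (determined? _) ∘ Sum.map ∈-++⁺ˡ ∈-++⁺ˡ ∘ ∈-toSubset⁻ (determined? L)
  , litAtom l
  , ∈-toSubset⁺ (determined? _) (lit-determined l (∈-++⁺ʳ L (here refl)))
  , simplify-undetermined P L l-atom ∘ ∈-toSubset⁻ (determined? L)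

module _ {P : Program k} {complete : CompleteProcedure k} (isComplete : IsCompleteProcedure complete) where

  extends-consistently : ∀ {L M} → IsStableModel P M → ConsistentWith M L → simplify P L ≢ []
                       → Any (λ A → ConsistentWith M (L ++ A)) (complete (simplify P L))
  extends-consistently (_ , least) consistent nonempty =
    let _ , lits , covers = isComplete _ nonempty
        A , A∈ , consistentA = find (covers _ (restriction-stable P least consistent))
    in lose A∈ (consistentWith-++ consistent
                  (restriction-consistentWith P least consistent (proj₂ (All.lookup lits A∈)) consistentA))

  mutual
    sval-bound : ∀ {L n} → SVal P complete L n → AtMostStableModels P L n
    sval-bound (s-empty empty) = atMost-subsingleton λ (stable , consistent) (stable' , consistent') →
      ⊆-antisym (proj₁ consistent' _ ∘ simplify-empty⇒⊆L⁺ P (proj₂ stable) consistent empty)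
                (proj₁ consistent _ ∘ simplify-empty⇒⊆L⁺ P (proj₂ stable') consistent' empty)
    sval-bound (s-incons inconsistent) = atMost-none (inconsistent ∘ consistentWith⇒consistent ∘ proj₂)
    sval-bound (s-step nonempty _ sum) =
      atMost-mono (λ (stable , consistent) → stable , extends-consistently stable consistent nonempty) (ssum-bound sum)

    ssum-bound : ∀ {L 𝒜 n} → SSum P complete L 𝒜 n
               → AtMost (λ M → IsStableModel P M × Any (λ A → ConsistentWith M (L ++ A)) 𝒜) n
    ssum-bound sum-nil = atMost-none λ { (_ , ()) }
    ssum-bound (sum-cons sval sum) =
      atMost-mono (λ { (stable , here c) → inj₁ (stable , c) ; (stable , there c) → inj₂ (stable , c) })
                  (atMost-∪ (sval-bound sval) (ssum-bound sum))

  sval-exists-acc : ∀ L → Acc _⊃_ (determined L) → Σ ℕ (SVal P complete L)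
  sval-exists-acc L (acc rec) with empty? (simplify P L) | consistent? L
  ... | yes empty | _ = 1 , s-empty empty
  ... | no _ | no inconsistent = 1 , s-incons inconsistent
  ... | no nonempty | yes consistent =
    let n , sum = sums _ (proj₁ (proj₂ (isComplete _ nonempty))) in n , s-step nonempty consistent sum
    where
    sums : ∀ 𝒜 → All (λ A → A ≢ [] × LitsOf (simplify P L) A) 𝒜 → Σ ℕ (SSum P complete L 𝒜)
    sums [] [] = 0 , sum-nil
    sums (A ∷ 𝒜) ((A≢[] , lits) ∷ rest) =
      let m , sval = sval-exists-acc (L ++ A) (rec (determined-⊂ P L A≢[] lits))
          r , sum = sums 𝒜 rest
      in m + r , sum-cons sval sum

  sval-exists : ∀ L → Σ ℕ (SVal P complete L)
  sval-exists L = sval-exists-acc L (⊃-wellFounded (determined L))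

corollary1 : ∀ {k} (P : Program k) (complete : CompleteProcedure k)
    → IsCompleteProcedure complete
    → ((L : List (Lit k)) → LitsOf P L
        → Σ ℕ (SVal P complete L)
          × (∀ n → SVal P complete L n → AtMostStableModels P L n))
      × (∀ n → SVal P complete [] n → AtMostStableModels P [] n)
corollary1 P complete isComplete =
  (λ L _ → sval-exists isComplete L , λ _ → sval-bound isComplete) , λ _ → sval-bound isComplete
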